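{- Let $G=(V,E)$ be a graph. Then $$\mathrm{ID}(G,x)=\sum_{W\subseteq V}(-1)^{|W|}(1-x)^{\mathrm{iso}(G[W])}.$$
   Context: All graphs are finite, simple and undirected. $\mathrm{iso}(H)$ is the number of isolated vertices of a graph $H$. $G[W]$ is the subgraph induced by $W$, and $\mathrm{iso}(G[\emptyset])=0$. A set $W\subseteq V$ is an independent dominating set of $G=(V,E)$ if every vertex of $V\setminus W$ is adjacent to at least one vertex of $W$ and no two vertices of $W$ are adjacent. The independent domination polynomial is $\mathrm{ID}(G,x)=\sum_{W}x^{|W|}$, the sum over all independent dominating sets $W$ of $G$. -}

module Defs where

open import Data.Nat using (ℕ; zero; suc)
open import Data.Bool using (Bool; true; false; _∧_; _∨_; not; if_then_else_)
open import Data.Fin using (Fin)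
open import Data.Fin.Subset using (Subset; _∈_; ∣_∣)
open import Data.Vec using (Vec; []; _∷_; lookup)
open import Data.List using (List; []; _∷_; map; _++_; foldr; allFin; filter; length)
open import Data.Bool.ListAction using (all; any)
open import Data.Integer using (ℤ; _+_; _*_; _-_; _^_; 0ℤ; 1ℤ; -1ℤ)
open import Relation.Binary.PropositionalEquality using (_≡_)

record Graph (n : ℕ) : Set where
  field
    adj   : Fin n → Fin n → Bool
    sym   : ∀ u v → adj u v ≡ adj v u
    irrefl : ∀ v → adj v v ≡ false
open Graph public

mem : {n : ℕ} → Subset n → Fin n → Bool
mem W v = lookup W v

subsets : (n : ℕ) → List (Subset n)
subsets zero = [] ∷ []
subsets (suc n) = map (true ∷_) (subsets n) ++ map (false ∷_) (subsets n)

independentB : {n : ℕ} → Graph n → Subset n → Bool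
independentB {n} G W =
  all (λ u → all (λ v → not (mem W u ∧ mem W v ∧ adj G u v)) (allFin n)) (allFin n)

dominatingB : {n : ℕ} → Graph n → Subset n → Bool
dominatingB {n} G W =
  all (λ v → mem W v ∨ any (λ w → mem W w ∧ adj G v w) (allFin n)) (allFin n)

isIDS : {n : ℕ} → Graph n → Subset n → Bool
isIDS G W = independentB G W ∧ dominatingB G W

iso : {n : ℕ} → Graph n → Subset n → ℕ
iso {n} G W =
  length (filter (λ v → Data.Bool._≟_ (mem W v ∧ not (any (λ w → mem W w ∧ adj G v w) (allFin n))) true) (allFin n))

sumℤ : List ℤ → ℤ
sumℤ = foldr _+_ 0ℤ

-- ID(G, x) evaluated at x : ℤ
ID : {n : ℕ} → Graph n → ℤ → ℤ
ID {n} G x = sumℤ (map (λ W → if isIDS G W then x ^ ∣ W ∣ else 0ℤ) (subsets n))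

rhs : {n : ℕ} → Graph n → ℤ → ℤ
rhs {n} G x = sumℤ (map (λ W → (-1ℤ ^ ∣ W ∣) * ((1ℤ - x) ^ iso G W)) (subsets n))

-- Writing Iso(W) for the isolated vertices of G[W], the binomial
-- theorem over subsets gives (1-x)^|Iso(W)| = Σ_{I ⊆ Iso(W)} (-x)^|I|, so after
-- exchanging the two sums the right-hand side is
--   Σ_I (-x)^|I| Σ_W (-1)^|W| [I ⊆ Iso(W)].
-- Now I ⊆ Iso(W) holds iff I ⊆ W and no vertex of W has a neighbour in I, a
-- condition that constrains each vertex u separately.  A signed sum over W of
-- such a "local" condition factors as a product over the vertices; the factor
-- of u vanishes unless u lies in I or has a neighbour in I, but not both, and
-- this is exactly the statement that I is an independent dominating set.  The
-- inner sum is therefore (-1)^|I| [I is an IDS] and the whole sum is ID(G,x).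
module Submission where

open import Defs
open import Data.Nat using (ℕ)
open import Data.Integer using (ℤ)
open import Relation.Binary.PropositionalEquality using (_≡_)

open import Algebra.Bundles using (CommutativeMonoid)
open import Data.Nat using (zero; suc)
open import Data.Bool using (Bool; true; false; _∧_; _∨_; not; if_then_else_)
open import Data.Bool.Properties using (∧-commutativeMonoid)
open import Data.Bool.ListAction using (all; any)
open import Data.Fin using (Fin) renaming (zero to fzero; suc to fsuc)
open import Data.Fin.Subset using (Subset; ∣_∣)
open import Data.Vec using ([]; _∷_)
open import Data.List using (List; []; _∷_; map; _++_; foldr; allFin; filter; length)
open import Data.List.Properties using (map-cong; map-++; map-∘; map-tabulate)
open import Data.Integer using (_+_; _*_; -_; _-_; _^_; 0ℤ; 1ℤ; -1ℤ)
open import Data.Integer.Properties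
  using (+-0-commutativeMonoid; *-1-commutativeMonoid; *-commutativeSemigroup;
         *-identityˡ; *-identityʳ; *-zeroʳ; *-comm; *-distribˡ-+; *-distribʳ-+;
         -1*i≡-i; neg-involutive; +-comm; *-assoc)
open import Function using (_∘_)
open import Relation.Binary.PropositionalEquality as ≡ using (refl; trans; cong; cong₂)

module Fold {c ℓ} (M : CommutativeMonoid c ℓ) where
  open CommutativeMonoid M renaming (refl to ≈-refl; sym to ≈-sym; trans to ≈-trans)
  open import Relation.Binary.Reasoning.Setoid setoid
  open import Algebra.Properties.CommutativeSemigroup commutativeSemigroup using (interchange)

  ∏ : List Carrier → Carrier
  ∏ = foldr _∙_ ε

  ∏-++ : (xs ys : List Carrier) → ∏ (xs ++ ys) ≈ ∏ xs ∙ ∏ ys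
  ∏-++ []       ys = ≈-sym (identityˡ (∏ ys))
  ∏-++ (x ∷ xs) ys = ≈-trans (∙-congˡ (∏-++ xs ys)) (≈-sym (assoc x (∏ xs) (∏ ys)))

  ∏-merge : {A : Set} (f g : A → Carrier) (xs : List A) →
            ∏ (map (λ a → f a ∙ g a) xs) ≈ ∏ (map f xs) ∙ ∏ (map g xs)
  ∏-merge f g []       = ≈-sym (identityˡ ε)
  ∏-merge f g (x ∷ xs) = ≈-trans (∙-congˡ (∏-merge f g xs)) (interchange (f x) (g x) _ _)

  ∏-ε : {A : Set} (xs : List A) → ∏ (map (λ _ → ε) xs) ≈ ε
  ∏-ε []       = ≈-refl
  ∏-ε (x ∷ xs) = ≈-trans (identityˡ _) (∏-ε xs)

  ∏-swap : {A B : Set} (F : A → B → Carrier) (xs : List A) (ys : List B) →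
           ∏ (map (λ a → ∏ (map (F a) ys)) xs) ≈ ∏ (map (λ b → ∏ (map (λ a → F a b) xs)) ys)
  ∏-swap F []       ys = ≈-sym (∏-ε ys)
  ∏-swap F (x ∷ xs) ys = begin
    ∏ (map (F x) ys) ∙ ∏ (map (λ a → ∏ (map (F a) ys)) xs)
      ≈⟨ ∙-congˡ (∏-swap F xs ys) ⟩
    ∏ (map (F x) ys) ∙ ∏ (map (λ b → ∏ (map (λ a → F a b) xs)) ys)
      ≈⟨ ≈-sym (∏-merge (F x) (λ b → ∏ (map (λ a → F a b) xs)) ys) ⟩
    ∏ (map (λ b → ∏ (map (λ a → F a b) (x ∷ xs))) ys) ∎

open ≡.≡-Reasoning
open import Algebra.Properties.CommutativeSemigroup *-commutativeSemigroup
  using () renaming (interchange to *-interchange; x∙yz≈y∙xz to *-left-comm)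

open Fold +-0-commutativeMonoid using ()
  renaming (∏-++ to sum-++; ∏-swap to sum-swap)
open Fold *-1-commutativeMonoid using () renaming (∏ to prodℤ; ∏-merge to prod-merge)
open Fold ∧-commutativeMonoid using () renaming (∏-merge to all-∧; ∏-swap to all-swap)

sum-cong : {A : Set} {f g : A → ℤ} → (∀ a → f a ≡ g a) → (xs : List A) →
           sumℤ (map f xs) ≡ sumℤ (map g xs)
sum-cong e xs = cong sumℤ (map-cong e xs)

prod-cong : {A : Set} {f g : A → ℤ} → (∀ a → f a ≡ g a) → (xs : List A) →
            prodℤ (map f xs) ≡ prodℤ (map g xs)
prod-cong e xs = cong prodℤ (map-cong e xs)

sum-scale : {A : Set} (c : ℤ) (f : A → ℤ) (xs : List A) →
            sumℤ (map (λ a → c * f a) xs) ≡ c * sumℤ (map f xs)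
sum-scale c f []       = ≡.sym (*-zeroʳ c)
sum-scale c f (x ∷ xs) =
  trans (cong (c * f x +_) (sum-scale c f xs)) (≡.sym (*-distribˡ-+ c (f x) _))

sum-interchange : {A B : Set} (f : A → ℤ) (g : B → ℤ) (h : A → B → ℤ) (xs : List A) (ys : List B) →
  sumℤ (map (λ a → f a * sumℤ (map (λ b → g b * h a b) ys)) xs)
    ≡ sumℤ (map (λ b → g b * sumℤ (map (λ a → f a * h a b) xs)) ys)
sum-interchange f g h xs ys = begin
  sumℤ (map (λ a → f a * sumℤ (map (λ b → g b * h a b) ys)) xs)
    ≡⟨ sum-cong (λ a → ≡.sym (sum-scale (f a) (λ b → g b * h a b) ys)) xs ⟩
  sumℤ (map (λ a → sumℤ (map (λ b → f a * (g b * h a b)) ys)) xs)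
    ≡⟨ sum-swap (λ a b → f a * (g b * h a b)) xs ys ⟩
  sumℤ (map (λ b → sumℤ (map (λ a → f a * (g b * h a b)) xs)) ys)
    ≡⟨ sum-cong (λ b → sum-cong (λ a → *-left-comm (f a) (g b) (h a b)) xs) ys ⟩
  sumℤ (map (λ b → sumℤ (map (λ a → g b * (f a * h a b)) xs)) ys)
    ≡⟨ sum-cong (λ b → sum-scale (g b) (λ a → f a * h a b) xs) ys ⟩
  sumℤ (map (λ b → g b * sumℤ (map (λ a → f a * h a b) xs)) ys) ∎

⟦_⟧ : Bool → ℤ
⟦ true  ⟧ = 1ℤ
⟦ false ⟧ = 0ℤ

⟦all⟧ : {A : Set} (p : A → Bool) (xs : List A) → ⟦ all p xs ⟧ ≡ prodℤ (map (⟦_⟧ ∘ p) xs)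
⟦all⟧ p []       = refl
⟦all⟧ p (x ∷ xs) with p x
... | true  = trans (⟦all⟧ p xs) (≡.sym (*-identityˡ _))
... | false = refl

⟦⟧-weight : (b : Bool) (c : ℤ) → ⟦ b ⟧ * c ≡ (if b then c else 0ℤ)
⟦⟧-weight true  c = *-identityˡ c
⟦⟧-weight false c = refl

pow-filter : {A : Set} (a : ℤ) (p : A → Bool) (xs : List A) →
  a ^ length (filter (λ v → Data.Bool._≟_ (p v) true) xs) ≡ prodℤ (map (λ v → if p v then a else 1ℤ) xs)
pow-filter a p []       = refl
pow-filter a p (x ∷ xs) with p x
... | true  = cong (a *_) (pow-filter a p xs)
... | false = trans (pow-filter a p xs) (≡.sym (*-identityˡ _))

^-distrib-* : (a b : ℤ) (k : ℕ) → (a * b) ^ k ≡ a ^ k * b ^ k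
^-distrib-* a b zero    = refl
^-distrib-* a b (suc k) =
  trans (cong (a * b *_) (^-distrib-* a b k)) (*-interchange a b (a ^ k) (b ^ k))

neg-pow : (x : ℤ) (k : ℕ) → (- x) ^ k * -1ℤ ^ k ≡ x ^ k
neg-pow x k = begin
  (- x) ^ k * -1ℤ ^ k ≡⟨ ≡.sym (^-distrib-* (- x) -1ℤ k) ⟩
  ((- x) * -1ℤ) ^ k   ≡⟨ cong (_^ k) (trans (*-comm (- x) -1ℤ) (-1*i≡-i (- x))) ⟩
  (- (- x)) ^ k       ≡⟨ cong (_^ k) (neg-involutive x) ⟩
  x ^ k               ∎

ΣW : {n : ℕ} → (Subset n → ℤ) → ℤ
ΣW {n} f = sumℤ (map f (subsets n))

ΠV : {n : ℕ} → (Fin n → ℤ) → ℤ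
ΠV {n} f = prodℤ (map f (allFin n))

ΣW-suc : {n : ℕ} (f : Subset (suc n) → ℤ) → ΣW f ≡ ΣW (λ W → f (true ∷ W)) + ΣW (λ W → f (false ∷ W))
ΣW-suc {n} f = begin
  sumℤ (map f (map (true ∷_) (subsets n) ++ map (false ∷_) (subsets n)))
    ≡⟨ cong sumℤ (map-++ f (map (true ∷_) (subsets n)) _) ⟩
  sumℤ (map f (map (true ∷_) (subsets n)) ++ map f (map (false ∷_) (subsets n)))
    ≡⟨ sum-++ (map f (map (true ∷_) (subsets n))) _ ⟩
  sumℤ (map f (map (true ∷_) (subsets n))) + sumℤ (map f (map (false ∷_) (subsets n)))
    ≡⟨ cong₂ (λ l r → sumℤ l + sumℤ r) (≡.sym (map-∘ (subsets n))) (≡.sym (map-∘ (subsets n))) ⟩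
  ΣW (λ W → f (true ∷ W)) + ΣW (λ W → f (false ∷ W)) ∎

ΠV-suc : {n : ℕ} (f : Fin (suc n) → ℤ) → ΠV f ≡ f fzero * ΠV (f ∘ fsuc)
ΠV-suc f = cong (λ l → f fzero * prodℤ l)
  (trans (map-tabulate fsuc f) (≡.sym (map-tabulate (λ v → v) (f ∘ fsuc))))

sum-of-products : (n : ℕ) (g : Fin n → Bool → ℤ) →
  ΣW (λ W → ΠV (λ v → g v (mem W v))) ≡ ΠV (λ v → g v true + g v false)
sum-of-products zero    g = refl
sum-of-products (suc n) g = begin
  ΣW (λ W → ΠV (λ v → g v (mem W v)))
    ≡⟨ ΣW-suc (λ W → ΠV (λ v → g v (mem W v))) ⟩
  ΣW (λ W → ΠV (λ v → g v (mem (true ∷ W) v))) + ΣW (λ W → ΠV (λ v → g v (mem (false ∷ W) v)))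
    ≡⟨ cong₂ _+_ (sum-cong (λ W → ΠV-suc (λ v → g v (mem (true ∷ W) v))) (subsets n))
                 (sum-cong (λ W → ΠV-suc (λ v → g v (mem (false ∷ W) v))) (subsets n)) ⟩
  ΣW (λ W → g fzero true * rest W) + ΣW (λ W → g fzero false * rest W)
    ≡⟨ cong₂ _+_ (sum-scale (g fzero true) rest (subsets n)) (sum-scale (g fzero false) rest (subsets n)) ⟩
  g fzero true * ΣW rest + g fzero false * ΣW rest
    ≡⟨ ≡.sym (*-distribʳ-+ (ΣW rest) (g fzero true) (g fzero false)) ⟩
  (g fzero true + g fzero false) * ΣW rest
    ≡⟨ cong ((g fzero true + g fzero false) *_) (sum-of-products n (g ∘ fsuc)) ⟩
  (g fzero true + g fzero false) * ΠV (λ v → g (fsuc v) true + g (fsuc v) false)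
    ≡⟨ ≡.sym (ΠV-suc (λ v → g v true + g v false)) ⟩
  ΠV (λ v → g v true + g v false) ∎
  where
  rest : Subset n → ℤ
  rest W = ΠV (λ v → g (fsuc v) (mem W v))

pow-card : (a : ℤ) {n : ℕ} (W : Subset n) → a ^ ∣ W ∣ ≡ ΠV (λ v → if mem W v then a else 1ℤ)
pow-card a []          = refl
pow-card a (true ∷ W)  =
  trans (cong (a *_) (pow-card a W)) (≡.sym (ΠV-suc (λ v → if mem (true ∷ W) v then a else 1ℤ)))
pow-card a (false ∷ W) =
  trans (trans (pow-card a W) (≡.sym (*-identityˡ _))) (≡.sym (ΠV-suc (λ v → if mem (false ∷ W) v then a else 1ℤ)))

-- The weighted count of the subsets W obeying a condition c that is local
-- (vertex u may be inside W iff c u true, outside iff c u false) factorises: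
--   Σ_W a^|W| [∀u. c u (u ∈ W)] = Π_u ([c u false] + a [c u true]).
local-sum : {n : ℕ} (a : ℤ) (c : Fin n → Bool → Bool) →
  ΣW (λ W → a ^ ∣ W ∣ * ⟦ all (λ u → c u (mem W u)) (allFin n) ⟧)
    ≡ ΠV (λ u → ⟦ c u false ⟧ + a * ⟦ c u true ⟧)
local-sum {n} a c = begin
  ΣW (λ W → a ^ ∣ W ∣ * ⟦ all (λ u → c u (mem W u)) (allFin n) ⟧)
    ≡⟨ sum-cong (λ W → cong₂ _*_ (pow-card a W) (⟦all⟧ (λ u → c u (mem W u)) (allFin n))) (subsets n) ⟩
  ΣW (λ W → ΠV (λ u → weight (mem W u)) * ΠV (λ u → ⟦ c u (mem W u) ⟧))
    ≡⟨ sum-cong (λ W → ≡.sym (prod-merge (λ u → weight (mem W u)) (λ u → ⟦ c u (mem W u) ⟧) (allFin n))) (subsets n) ⟩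
  ΣW (λ W → ΠV (λ u → weight (mem W u) * ⟦ c u (mem W u) ⟧))
    ≡⟨ sum-of-products n (λ u b → weight b * ⟦ c u b ⟧) ⟩
  ΠV (λ u → a * ⟦ c u true ⟧ + 1ℤ * ⟦ c u false ⟧)
    ≡⟨ prod-cong (λ u → trans (cong (a * ⟦ c u true ⟧ +_) (*-identityˡ _)) (+-comm (a * ⟦ c u true ⟧) ⟦ c u false ⟧)) (allFin n) ⟩
  ΠV (λ u → ⟦ c u false ⟧ + a * ⟦ c u true ⟧) ∎
  where
  weight : Bool → ℤ
  weight b = if b then a else 1ℤ

all-cong : {A : Set} {p q : A → Bool} → (∀ a → p a ≡ q a) → (xs : List A) → all p xs ≡ all q xs
all-cong e xs = cong (foldr _∧_ true) (map-cong e xs)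

all-not-guard : {A : Set} (b : Bool) (p : A → Bool) (xs : List A) →
                all (λ a → not (b ∧ p a)) xs ≡ not (b ∧ any p xs)
all-not-guard false p []       = refl
all-not-guard false p (x ∷ xs) = all-not-guard false p xs
all-not-guard true  p []       = refl
all-not-guard true  p (x ∷ xs) with p x
... | true  = refl
... | false = all-not-guard true p xs

module _ {n : ℕ} (G : Graph n) where

  nbrIn : Subset n → Fin n → Bool
  nbrIn W v = any (λ w → mem W w ∧ adj G v w) (allFin n)

  isolatedIn : Subset n → Fin n → Bool
  isolatedIn W v = mem W v ∧ not (nbrIn W v)

  _⊆Iso_ : Subset n → Subset n → Bool
  I ⊆Iso W = all (λ v → not (mem I v) ∨ isolatedIn W v) (allFin n)

  no-edges-sym : (A B : Subset n) →
    all (λ v → not (mem A v ∧ nbrIn B v)) (allFin n) ≡ all (λ w → not (mem B w ∧ nbrIn A w)) (allFin n)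
  no-edges-sym A B = begin
    all (λ v → not (mem A v ∧ nbrIn B v)) V
      ≡⟨ all-cong (λ v → ≡.sym (all-not-guard (mem A v) (λ w → mem B w ∧ adj G v w) V)) V ⟩
    all (λ v → all (λ w → not (mem A v ∧ (mem B w ∧ adj G v w))) V) V
      ≡⟨ all-swap (λ v w → not (mem A v ∧ (mem B w ∧ adj G v w))) V V ⟩
    all (λ w → all (λ v → not (mem A v ∧ (mem B w ∧ adj G v w))) V) V
      ≡⟨ all-cong (λ w → all-cong (λ v → edge-flip (mem A v) (mem B w) (Graph.sym G v w)) V) V ⟩
    all (λ w → all (λ v → not (mem B w ∧ (mem A v ∧ adj G w v))) V) V
      ≡⟨ all-cong (λ w → all-not-guard (mem B w) (λ v → mem A v ∧ adj G w v) V) V ⟩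
    all (λ w → not (mem B w ∧ nbrIn A w)) V ∎
    where
    V = allFin n
    edge-flip : ∀ a b {e e'} → e ≡ e' → not (a ∧ (b ∧ e)) ≡ not (b ∧ (a ∧ e'))
    edge-flip true  true  refl = refl
    edge-flip true  false _    = refl
    edge-flip false true  _    = refl
    edge-flip false false _    = refl

  -- the status b (u ∈ W or not) that a vertex u may take when I ⊆ Iso(W):
  -- u ∈ I forces u ∈ W, and a neighbour of I (a = u ∈ N(I)) cannot be in W
  allowed : (i a b : Bool) → Bool
  allowed i a b = (not i ∨ b) ∧ not (b ∧ a)

  ⊆Iso-local : (I W : Subset n) →
    I ⊆Iso W ≡ all (λ u → allowed (mem I u) (nbrIn I u) (mem W u)) (allFin n)
  ⊆Iso-local I W = begin
    all (λ v → not (mem I v) ∨ isolatedIn W v) V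
      ≡⟨ all-cong (λ v → split (mem I v) (mem W v) (nbrIn W v)) V ⟩
    all (λ v → (not (mem I v) ∨ mem W v) ∧ not (mem I v ∧ nbrIn W v)) V
      ≡⟨ all-∧ (λ v → not (mem I v) ∨ mem W v) (λ v → not (mem I v ∧ nbrIn W v)) V ⟩
    all (λ v → not (mem I v) ∨ mem W v) V ∧ all (λ v → not (mem I v ∧ nbrIn W v)) V
      ≡⟨ cong (all (λ v → not (mem I v) ∨ mem W v) V ∧_) (no-edges-sym I W) ⟩
    all (λ v → not (mem I v) ∨ mem W v) V ∧ all (λ u → not (mem W u ∧ nbrIn I u)) V
      ≡⟨ ≡.sym (all-∧ (λ u → not (mem I u) ∨ mem W u) (λ u → not (mem W u ∧ nbrIn I u)) V) ⟩
    all (λ u → allowed (mem I u) (nbrIn I u) (mem W u)) V ∎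
    where
    V = allFin n
    split : ∀ i w e → (not i ∨ (w ∧ not e)) ≡ (not i ∨ w) ∧ not (i ∧ e)
    split true  true  _ = refl
    split true  false _ = refl
    split false _     _ = refl

  exactlyOne : (i a : Bool) → Bool
  exactlyOne i a = not (i ∧ a) ∧ (i ∨ a)

  isIDS-local : (I : Subset n) → isIDS G I ≡ all (λ u → exactlyOne (mem I u) (nbrIn I u)) (allFin n)
  isIDS-local I = begin
    independentB G I ∧ dominatingB G I
      ≡⟨ cong (_∧ dominatingB G I)
              (all-cong (λ u → all-not-guard (mem I u) (λ v → mem I v ∧ adj G u v) V) V) ⟩
    all (λ u → not (mem I u ∧ nbrIn I u)) V ∧ all (λ u → mem I u ∨ nbrIn I u) V
      ≡⟨ ≡.sym (all-∧ (λ u → not (mem I u ∧ nbrIn I u)) (λ u → mem I u ∨ nbrIn I u) V) ⟩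
    all (λ u → exactlyOne (mem I u) (nbrIn I u)) V ∎
    where V = allFin n

  signed-allowed : ∀ i a →
    ⟦ allowed i a false ⟧ + -1ℤ * ⟦ allowed i a true ⟧ ≡ (if i then -1ℤ else 1ℤ) * ⟦ exactlyOne i a ⟧
  signed-allowed true  true  = refl
  signed-allowed true  false = refl
  signed-allowed false true  = refl
  signed-allowed false false = refl

  iso-expansion : (x : ℤ) (W : Subset n) →
    (1ℤ - x) ^ iso G W ≡ ΣW (λ I → (- x) ^ ∣ I ∣ * ⟦ I ⊆Iso W ⟧)
  iso-expansion x W = begin
    (1ℤ - x) ^ iso G W
      ≡⟨ pow-filter (1ℤ - x) (isolatedIn W) (allFin n) ⟩
    ΠV (λ v → if isolatedIn W v then 1ℤ - x else 1ℤ)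
      ≡⟨ prod-cong (λ v → one-step (isolatedIn W v)) (allFin n) ⟩
    ΠV (λ v → 1ℤ + (- x) * ⟦ isolatedIn W v ⟧)
      ≡⟨ ≡.sym (local-sum (- x) (λ v b → not b ∨ isolatedIn W v)) ⟩
    ΣW (λ I → (- x) ^ ∣ I ∣ * ⟦ I ⊆Iso W ⟧) ∎
    where
    one-step : ∀ s → (if s then 1ℤ - x else 1ℤ) ≡ 1ℤ + (- x) * ⟦ s ⟧
    one-step true  = cong (1ℤ +_) (≡.sym (*-identityʳ (- x)))
    one-step false = cong (1ℤ +_) (≡.sym (*-zeroʳ (- x)))

  signed-count : (I : Subset n) → ΣW (λ W → -1ℤ ^ ∣ W ∣ * ⟦ I ⊆Iso W ⟧) ≡ -1ℤ ^ ∣ I ∣ * ⟦ isIDS G I ⟧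
  signed-count I = begin
    ΣW (λ W → -1ℤ ^ ∣ W ∣ * ⟦ I ⊆Iso W ⟧)
      ≡⟨ sum-cong (λ W → cong (λ b → -1ℤ ^ ∣ W ∣ * ⟦ b ⟧) (⊆Iso-local I W)) (subsets n) ⟩
    ΣW (λ W → -1ℤ ^ ∣ W ∣ * ⟦ all (λ u → allowed (mem I u) (nbrIn I u) (mem W u)) V ⟧)
      ≡⟨ local-sum -1ℤ (λ u → allowed (mem I u) (nbrIn I u)) ⟩
    ΠV (λ u → ⟦ allowed (mem I u) (nbrIn I u) false ⟧ + -1ℤ * ⟦ allowed (mem I u) (nbrIn I u) true ⟧)
      ≡⟨ prod-cong (λ u → signed-allowed (mem I u) (nbrIn I u)) V ⟩
    ΠV (λ u → (if mem I u then -1ℤ else 1ℤ) * ⟦ exactlyOne (mem I u) (nbrIn I u) ⟧)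
      ≡⟨ prod-merge (λ u → if mem I u then -1ℤ else 1ℤ) (λ u → ⟦ exactlyOne (mem I u) (nbrIn I u) ⟧) V ⟩
    ΠV (λ u → if mem I u then -1ℤ else 1ℤ) * ΠV (λ u → ⟦ exactlyOne (mem I u) (nbrIn I u) ⟧)
      ≡⟨ cong₂ _*_ (≡.sym (pow-card -1ℤ I)) (≡.sym (⟦all⟧ (λ u → exactlyOne (mem I u) (nbrIn I u)) V)) ⟩
    -1ℤ ^ ∣ I ∣ * ⟦ all (λ u → exactlyOne (mem I u) (nbrIn I u)) V ⟧
      ≡⟨ cong (λ b → -1ℤ ^ ∣ I ∣ * ⟦ b ⟧) (≡.sym (isIDS-local I)) ⟩
    -1ℤ ^ ∣ I ∣ * ⟦ isIDS G I ⟧ ∎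
    where V = allFin n

mainTheorem8 : (n : ℕ) (G : Graph n) (x : ℤ) → ID G x ≡ rhs G x
mainTheorem8 n G x = ≡.sym (begin
  ΣW (λ W → -1ℤ ^ ∣ W ∣ * (1ℤ - x) ^ iso G W)
    ≡⟨ sum-cong (λ W → cong (-1ℤ ^ ∣ W ∣ *_) (iso-expansion G x W)) (subsets n) ⟩
  ΣW (λ W → -1ℤ ^ ∣ W ∣ * ΣW (λ I → (- x) ^ ∣ I ∣ * ⟦ _⊆Iso_ G I W ⟧))
    ≡⟨ sum-interchange (λ W → -1ℤ ^ ∣ W ∣) (λ I → (- x) ^ ∣ I ∣) (λ W I → ⟦ _⊆Iso_ G I W ⟧) (subsets n) (subsets n) ⟩
  ΣW (λ I → (- x) ^ ∣ I ∣ * ΣW (λ W → -1ℤ ^ ∣ W ∣ * ⟦ _⊆Iso_ G I W ⟧))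
    ≡⟨ sum-cong (λ I → cong ((- x) ^ ∣ I ∣ *_) (signed-count G I)) (subsets n) ⟩
  ΣW (λ I → (- x) ^ ∣ I ∣ * (-1ℤ ^ ∣ I ∣ * ⟦ isIDS G I ⟧))
    ≡⟨ sum-cong (λ I → ids-term I) (subsets n) ⟩
  ΣW (λ I → if isIDS G I then x ^ ∣ I ∣ else 0ℤ) ∎)
  where
  ids-term : (I : Subset n) → (- x) ^ ∣ I ∣ * (-1ℤ ^ ∣ I ∣ * ⟦ isIDS G I ⟧) ≡ (if isIDS G I then x ^ ∣ I ∣ else 0ℤ)
  ids-term I = begin
    (- x) ^ ∣ I ∣ * (-1ℤ ^ ∣ I ∣ * ⟦ isIDS G I ⟧) ≡⟨ ≡.sym (*-assoc ((- x) ^ ∣ I ∣) _ _) ⟩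
    (- x) ^ ∣ I ∣ * -1ℤ ^ ∣ I ∣ * ⟦ isIDS G I ⟧   ≡⟨ cong (_* ⟦ isIDS G I ⟧) (neg-pow x ∣ I ∣) ⟩
    x ^ ∣ I ∣ * ⟦ isIDS G I ⟧                     ≡⟨ *-comm (x ^ ∣ I ∣) _ ⟩
    ⟦ isIDS G I ⟧ * x ^ ∣ I ∣                     ≡⟨ ⟦⟧-weight (isIDS G I) (x ^ ∣ I ∣) ⟩
    (if isIDS G I then x ^ ∣ I ∣ else 0ℤ)         ∎
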